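{- Let $p\ge5$ be a prime and let $1\le j\le p-1$. For all integers $n\ge0$ and $\alpha\ge0$: (i) $\displaystyle\sum_{n=0}^\infty \overline{p}_{6,12}\big(24\cdot p^{2\alpha}n+p^{2\alpha}\big)q^n\equiv 2f_1\pmod4$; (ii) $\overline{p}_{6,12}\big(p^{2\alpha+1}(24(pn+j)+p)\big)\equiv0\pmod4$.
   Context: For $|q|<1$ and a positive integer $m$, $f_m:=\prod_{i=1}^{\infty}(1-q^{mi})$, and $(a;q)_\infty=\prod_{i\ge0}(1-aq^i)$. An overpartition of $n$ is a partition of $n$ in which the first occurrence of each part size may be overlined. A $(6,12)$-regular overpartition of $n$ is an overpartition of $n$ none of whose parts is congruent to $6$ modulo $12$; $\overline{p}_{6,12}(n)$ denotes their number, with $\overline{p}_{6,12}(0)=1$, so that $\sum_{n\ge0}\overline{p}_{6,12}(n)q^n=\frac{(-q;q)_\infty(q^6;q^{12})_\infty}{(q;q)_\infty(-q^6;q^{12})_\infty}$. A congruence between power series in $q$ modulo $M$ means corresponding coefficients are congruent modulo $M$. -}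

module Defs where

open import Data.Nat using (ℕ; zero; suc; _+_; _*_; _∸_; _≤ᵇ_; _%_)
open import Data.Bool using (Bool; true; false; if_then_else_; not)
open import Data.List using (List; map; upTo)
open import Data.Nat.ListAction using (sum)
open import Data.Integer using (ℤ; +_) renaming (_-_ to _-ℤ_)

allowed : ℕ → Bool
allowed d = not (d % 12 Data.Nat.≡ᵇ 6)

-- ov k n = number of overpartitions of n all of whose parts lie in {1,…,k}
-- and are allowed (i.e. not ≡ 6 mod 12).
-- An overpartition is determined by choosing, for each part size d, a
-- multiplicity m ≥ 0 and, when m ≥ 1, whether the first occurrence of d is
-- overlined (2 choices).
ov : ℕ → ℕ → ℕ
ov zero zero = 1
ov zero (suc n) = 0
ov (suc k) n =
  ov k n +
  (if allowed (suc k)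
   then 2 * sum (map (λ m → if (suc m * suc k) ≤ᵇ n then ov k (n ∸ suc m * suc k) else 0) (upTo n))
   else 0)

pbar612 : ℕ → ℕ
pbar612 n = ov n n

-- prodF k = coefficients of ∏_{i=1}^{k} (1 − q^i) as a function ℕ → ℤ.
prodF : ℕ → ℕ → ℤ
prodF zero zero = + 1
prodF zero (suc n) = + 0
prodF (suc k) n = prodF k n -ℤ (if suc k ≤ᵇ n then prodF k (n ∸ suc k) else + 0)

-- f₁coeff n = coefficient of q^n in f₁ = ∏_{i≥1}(1 − q^i)
-- (factors with i > n do not affect the coefficient of q^n).
f1coeff : ℕ → ℤ
f1coeff n = prodF n n

{-# OPTIONS --safe #-}
-- Overpartitions with a given underlying partition come in groups of 2^s, where s is the
-- number of distinct parts, so modulo 4 only the partitions of N into copies of a single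
-- allowed part d ∣ N survive, each counted twice: p̄₆,₁₂(N) ≡ 2·#{d ∣ N : d ≢ 6 (mod 12)}.
-- For odd N every divisor is allowed, and the divisors pair off as d ↔ N/d except √N, so
-- p̄₆,₁₂(N) ≡ 2·[N is a square] (mod 4). Modulo 2 Euler's pentagonal theorem reads
-- f₁ ≡ Σ_t [24t + 1 is a square] q^t. Finally p^{2α}(24n + 1) is a square iff 24n + 1 is,
-- and p^{2α+1}(24(pn + j) + p) is never a square because p ∤ 24(pn + j) + p.

module Submission where

open import Defs
open import Algebra.Bundles using (CommutativeRing)
open import Data.Bool using (Bool; true; false; _∧_; _xor_; if_then_else_)
open import Data.Bool.Properties
  using (¬-not; xor-assoc; xor-comm; xor-same; xor-identityʳ; ∧-zeroʳ; ∧-identityʳ; xor-∧-commutativeRing; T-≡)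
open import Data.Empty using (⊥-elim)
open import Data.Integer using (ℤ; +_) renaming (_-_ to _-ℤ_; _*_ to _*ℤ_; _+_ to _+ℤ_)
import Data.Integer as ℤ
open import Data.Integer.Divisibility using () renaming (_∣_ to _∣ℤ_)
import Data.Integer.Properties as ℤ
import Data.Integer.Tactic.RingSolver as ℤ-Solver
open import Data.List using (map; applyUpTo)
open import Data.Nat using (ℕ; zero; suc; _+_; _*_; _∸_; _^_; _≤_; _<_; _≤ᵇ_; _≡ᵇ_; _<ᵇ_; _%_; _/_; s≤s; z≤n; NonZero)
open import Data.Nat.DivMod using (m≡m%n+[m/n]*n; [m+kn]%n≡m%n; m%n<n)
open import Data.Nat.Divisibility
  using (_∣_; divides; _∣0; ∣-refl; m∣m*n; ∣m⇒∣m*n; ∣n⇒∣m*n; ∣m+n∣m⇒∣n; ∣n∣m%n⇒∣m; ∣⇒≤; ∣1⇒≡1)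
open import Data.Nat.ListAction using (sum)
open import Data.Nat.Primality using (Prime; euclidsLemma; prime⇒nonZero; prime⇒irreducible; prime[2]; ¬prime[1])
open import Data.Nat.Properties
open import Data.Nat.Tactic.RingSolver using (solve-∀)
open import Data.Product using (_×_; _,_; ∃)
open import Data.Sum using (_⊎_; inj₁; inj₂)
open import Function using (_∘_)
open import Function.Bundles using (_⇔_; mk⇔; Equivalence)
open import Function.Construct.Composition using (_⇔-∘_)
open import Function.Construct.Symmetry using (⇔-sym)
open import Relation.Binary using (tri<; tri≈; tri>)
open import Relation.Binary.PropositionalEquality
open import Relation.Nullary using (¬_; yes; no)
open import Relation.Nullary.Decidable using (dec-true; dec-false)

open CommutativeRing xor-∧-commutativeRing using ()
  renaming (+-commutativeSemigroup to xor-commutativeSemigroup)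
open import Algebra.Properties.CommutativeSemigroup xor-commutativeSemigroup using ()
  renaming (interchange to xor-interchange)

bit : Bool → ℕ
bit false = 0
bit true  = 1

bit-+ : ∀ x y → bit x + bit y ≡ 2 * bit (x ∧ y) + bit (x xor y)
bit-+ false false = refl
bit-+ false true  = refl
bit-+ true  false = refl
bit-+ true  true  = refl

bool-ext : ∀ {b c} → (b ≡ true ⇔ c ≡ true) → b ≡ c
bool-ext {false} {false} _  = refl
bool-ext {false} {true}  b⇔c = Equivalence.from b⇔c refl
bool-ext {true}  {false} b⇔c = sym (Equivalence.to b⇔c refl)
bool-ext {true}  {true}  _  = refl

xor-cancelʳ : ∀ x y → x xor (y xor x) ≡ y
xor-cancelʳ x y = begin
  x xor (y xor x) ≡⟨ cong (x xor_) (xor-comm y x) ⟩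
  x xor (x xor y) ≡⟨ xor-assoc x x y ⟨
  (x xor x) xor y ≡⟨ cong (_xor y) (xor-same x) ⟩
  y               ∎
  where open ≡-Reasoning

xor-flip : ∀ {s a c} → c ≡ s xor a → a ≡ s xor c
xor-flip {s} {a} refl = sym (trans (sym (xor-assoc s s a)) (cong (_xor a) (xor-same s)))

xor-cancel-middle : ∀ s x b → (s xor x) xor (x xor b) ≡ s xor b
xor-cancel-middle s x b = begin
  (s xor x) xor (x xor b) ≡⟨ cong ((s xor x) xor_) (xor-comm x b) ⟩
  (s xor x) xor (b xor x) ≡⟨ xor-interchange s x b x ⟩
  (s xor b) xor (x xor x) ≡⟨ cong ((s xor b) xor_) (xor-same x) ⟩
  (s xor b) xor false     ≡⟨ xor-identityʳ (s xor b) ⟩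
  s xor b                 ∎
  where open ≡-Reasoning

xor-true : ∀ a b → a xor b ≡ true → a ≡ true ⊎ b ≡ true
xor-true true  b _       = inj₁ refl
xor-true false b b≡true = inj₂ b≡true

≡ᵇ-true : ∀ {m n} → m ≡ n → (m ≡ᵇ n) ≡ true
≡ᵇ-true {m} {n} = dec-true (m ≟ n)

≡ᵇ-false : ∀ {m n} → m ≢ n → (m ≡ᵇ n) ≡ false
≡ᵇ-false {m} {n} = dec-false (m ≟ n)

≡ᵇ-true⇒≡ : ∀ {m n} → (m ≡ᵇ n) ≡ true → m ≡ n
≡ᵇ-true⇒≡ {m} {n} e = ≡ᵇ⇒≡ m n (Equivalence.from T-≡ e)

≤ᵇ-true : ∀ {m n} → m ≤ n → (m ≤ᵇ n) ≡ true
≤ᵇ-true {m} {n} = dec-true (m ≤? n)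

≤ᵇ-false : ∀ {m n} → ¬ m ≤ n → (m ≤ᵇ n) ≡ false
≤ᵇ-false {m} {n} = dec-false (m ≤? n)

<ᵇ-true : ∀ {m n} → m < n → (m <ᵇ n) ≡ true
<ᵇ-true m<n = Equivalence.to T-≡ (<⇒<ᵇ m<n)

<ᵇ-false : ∀ {m n} → ¬ m < n → (m <ᵇ n) ≡ false
<ᵇ-false = ≤ᵇ-false

-- Parity of a finite count

parity : (ℕ → Bool) → ℕ → Bool
parity f zero    = false
parity f (suc n) = parity f n xor f n

parity-cong : ∀ {f g} n → (∀ m → m < n → f m ≡ g m) → parity f n ≡ parity g n
parity-cong zero    f≗g = refl
parity-cong (suc n) f≗g = cong₂ _xor_ (parity-cong n (λ m m<n → f≗g m (m<n⇒m<1+n m<n))) (f≗g n ≤-refl)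

parity-xor : ∀ f g n → parity (λ m → f m xor g m) n ≡ parity f n xor parity g n
parity-xor f g zero    = refl
parity-xor f g (suc n) =
  trans (cong (_xor (f n xor g n)) (parity-xor f g n)) (xor-interchange (parity f n) (parity g n) (f n) (g n))

parity-false : ∀ f n → (∀ m → m < n → f m ≡ false) → parity f n ≡ false
parity-false f zero    _   = refl
parity-false f (suc n) f≡0 =
  cong₂ _xor_ (parity-false f n (λ m m<n → f≡0 m (m<n⇒m<1+n m<n))) (f≡0 n ≤-refl)

parity-single : ∀ f n k → k < n → (∀ m → m < n → m ≢ k → f m ≡ false) → parity f n ≡ f k
parity-single f (suc n) k k<1+n f≡0 with k ≟ n
... | yes refl = cong (_xor f k) (parity-false f n (λ m m<n → f≡0 m (m<n⇒m<1+n m<n) (<⇒≢ m<n)))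
... | no k≢n   = begin
  parity f n xor f n ≡⟨ cong₂ _xor_ (parity-single f n k k<n (λ m m<n → f≡0 m (m<n⇒m<1+n m<n)))
                                    (f≡0 n ≤-refl (k≢n ∘ sym)) ⟩
  f k xor false      ≡⟨ xor-identityʳ (f k) ⟩
  f k                ∎
  where
    open ≡-Reasoning
    k<n : k < n
    k<n = ≤∧≢⇒< (≤-pred k<1+n) k≢n

parity-true⇒∃ : ∀ f n → parity f n ≡ true → ∃ λ m → m < n × f m ≡ true
parity-true⇒∃ f (suc n) odd with parity f n in eq | f n in fn
... | true  | _    = let (m , m<n , fm) = parity-true⇒∃ f n eq in m , m<n⇒m<1+n m<n , fm
... | false | true = n , ≤-refl , fn

parity-suc : ∀ f n → parity f (suc n) ≡ f 0 xor parity (f ∘ suc) n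
parity-suc f zero    = sym (xor-identityʳ (f 0))
parity-suc f (suc n) =
  trans (cong (_xor f (suc n)) (parity-suc f n)) (xor-assoc (f 0) (parity (f ∘ suc) n) (f (suc n)))

parity-swap : ∀ (g : ℕ → ℕ → Bool) n m →
              parity (λ a → parity (g a) m) n ≡ parity (λ b → parity (λ a → g a b) n) m
parity-swap g zero    m = sym (parity-false _ m (λ _ _ → refl))
parity-swap g (suc n) m =
  trans (cong (_xor parity (g n) m) (parity-swap g n m)) (sym (parity-xor (λ b → parity (λ a → g a b) n) (g n) m))

sum-parity : ∀ (h : ℕ → ℕ) (g : ℕ → Bool) → (∀ m → ∃ λ a → h m ≡ 2 * a + bit (g m)) →
             ∀ n f → ∃ λ c → sum (map h (applyUpTo f n)) ≡ 2 * c + bit (parity (g ∘ f) n)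
sum-parity h g h≡g zero    f = 0 , refl
sum-parity h g h≡g (suc n) f with a , ha ← h≡g (f 0) | c , hc ← sum-parity h g h≡g n (f ∘ suc) =
  a + c + bit (x ∧ y) ,
  (begin
    h (f 0) + sum (map h (applyUpTo (f ∘ suc) n))    ≡⟨ cong₂ _+_ ha hc ⟩
    2 * a + bit x + (2 * c + bit y)                  ≡⟨ regroup a c (bit x) (bit y) ⟩
    2 * (a + c) + (bit x + bit y)                    ≡⟨ cong (λ z → 2 * (a + c) + z) (bit-+ x y) ⟩
    2 * (a + c) + (2 * bit (x ∧ y) + bit (x xor y))  ≡⟨ regroup′ a c (bit (x ∧ y)) (bit (x xor y)) ⟩
    2 * (a + c + bit (x ∧ y)) + bit (x xor y)        ≡⟨ cong (λ z → 2 * (a + c + bit (x ∧ y)) + bit z)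
                                                             (parity-suc (g ∘ f) n) ⟨
    2 * (a + c + bit (x ∧ y)) + bit (parity (g ∘ f) (suc n)) ∎)
  where
    open ≡-Reasoning
    x = g (f 0)
    y = parity (g ∘ f ∘ suc) n
    regroup : ∀ a c x y → 2 * a + x + (2 * c + y) ≡ 2 * (a + c) + (x + y)
    regroup = solve-∀
    regroup′ : ∀ a c z w → 2 * (a + c) + (2 * z + w) ≡ 2 * (a + c + z) + w
    regroup′ = solve-∀

-- Overpartitions modulo 4

quotientParity : ℕ → ℕ → Bool
quotientParity c n = parity (λ m → suc m * c ≡ᵇ n) n

allowedDivisorParity : ℕ → ℕ → Bool
allowedDivisorParity k n = parity (λ d → allowed (suc d) ∧ quotientParity (suc d) n) k

ov-0 : ∀ k → ov k 0 ≡ 1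
ov-0 zero    = refl
ov-0 (suc k) with allowed (suc k)
... | true  = trans (+-identityʳ (ov k 0)) (ov-0 k)
... | false = trans (+-identityʳ (ov k 0)) (ov-0 k)

n∸m≡1+r⇒m≢n : ∀ {m n r} → n ∸ m ≡ suc r → m ≢ n
n∸m≡1+r⇒m≢n {n = n} n∸n≡1+r refl = 0≢1+n (trans (sym (n∸n≡0 n)) n∸n≡1+r)

shifted-parity : ∀ (g : ℕ → ℕ) → g 0 ≡ 1 → (∀ r → ∃ λ a → g (suc r) ≡ 2 * a) →
                 ∀ c n → ∃ λ a → (if c ≤ᵇ n then g (n ∸ c) else 0) ≡ 2 * a + bit (c ≡ᵇ n)
shifted-parity g g0≡1 g-even c n with c ≤? n
... | no c≰n rewrite ≤ᵇ-false c≰n | ≡ᵇ-false (c≰n ∘ ≤-reflexive) = 0 , refl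
... | yes c≤n rewrite ≤ᵇ-true c≤n with n ∸ c in n∸c≡r
...   | zero  rewrite ≡ᵇ-true (≤-antisym c≤n (m∸n≡0⇒m≤n n∸c≡r)) = 0 , g0≡1
...   | suc r with a , ga ← g-even r =
  a , trans ga (sym (trans (cong (λ b → 2 * a + bit b) (≡ᵇ-false (n∸m≡1+r⇒m≢n {c} n∸c≡r))) (+-identityʳ (2 * a))))

-- ov k r is even for r ≥ 1, so modulo 2 the inner sum of ov (suc k) n only counts
-- the m with (m + 1)(k + 1) = n.
ov-mod4 : ∀ k n → 1 ≤ n → ∃ λ a → ov k n ≡ 4 * a + 2 * bit (allowedDivisorParity k n)
ov-mod4 zero    (suc n) _   = 0 , refl
ov-mod4 (suc k) n       1≤n with a , ova ← ov-mod4 k n 1≤n | allowed (suc k)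
... | false = a , trans (+-identityʳ (ov k n))
                  (trans ova (cong (λ b → 4 * a + 2 * bit b) (sym (xor-identityʳ (allowedDivisorParity k n)))))
... | true = combine (sum-parity _ _ (λ m → shifted-parity (ov k) (ov-0 k) ov-even (suc m * suc k) n) n (λ m → m))
  where
    x = allowedDivisorParity k n
    y = quotientParity (suc k) n
    combine : ∀ {S} → (∃ λ s → S ≡ 2 * s + bit y) → ∃ λ b → ov k n + 2 * S ≡ 4 * b + 2 * bit (x xor y)
    combine {S} (s , sums) = a + s + bit (x ∧ y) , (begin
      ov k n + 2 * S                                       ≡⟨ cong₂ (λ u v → u + 2 * v) ova sums ⟩
      4 * a + 2 * bit x + 2 * (2 * s + bit y)              ≡⟨ regroup a s (bit x) (bit y) ⟩
      4 * (a + s) + 2 * (bit x + bit y)                    ≡⟨ cong (λ z → 4 * (a + s) + 2 * z) (bit-+ x y) ⟩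
      4 * (a + s) + 2 * (2 * bit (x ∧ y) + bit (x xor y))  ≡⟨ regroup′ a s (bit (x ∧ y)) (bit (x xor y)) ⟩
      4 * (a + s + bit (x ∧ y)) + 2 * bit (x xor y)        ∎)
      where
        open ≡-Reasoning
        regroup : ∀ a s x y → 4 * a + 2 * x + 2 * (2 * s + y) ≡ 4 * (a + s) + 2 * (x + y)
        regroup = solve-∀
        regroup′ : ∀ a s z w → 4 * (a + s) + 2 * (2 * z + w) ≡ 4 * (a + s + z) + 2 * w
        regroup′ = solve-∀
    ov-even : ∀ r → ∃ λ b → ov k (suc r) ≡ 2 * b
    ov-even r with b , ovb ← ov-mod4 k (suc r) (s≤s z≤n) =
      2 * b + bit (allowedDivisorParity k (suc r)) , trans ovb (double b _)
      where
        double : ∀ b c → 4 * b + 2 * c ≡ 2 * (2 * b + c)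
        double = solve-∀

-- Divisors and squares

allowed-odd-divisor : ∀ {N m d} → ¬ 2 ∣ N → m * d ≡ N → allowed d ≡ true
allowed-odd-divisor {N} {m} {d} 2∤N md≡N with d % 12 ≡ᵇ 6 in d%12≡ᵇ6
... | false = refl
... | true  = ⊥-elim (2∤N (subst (2 ∣_) md≡N (∣n⇒∣m*n m 2∣d)))
  where
    2∣d : 2 ∣ d
    2∣d = ∣n∣m%n⇒∣m {n = 12} (divides 6 refl) (subst (2 ∣_) (sym (≡ᵇ-true⇒≡ d%12≡ᵇ6)) (divides 3 refl))

allowedDivisorParity-odd : ∀ k N → ¬ 2 ∣ N → allowedDivisorParity k N ≡ parity (λ d → quotientParity (suc d) N) k
allowedDivisorParity-odd k N 2∤N = parity-cong k allowed∧q≡q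
  where
    allowed∧q≡q : ∀ d → d < k → allowed (suc d) ∧ quotientParity (suc d) N ≡ quotientParity (suc d) N
    allowed∧q≡q d _ with quotientParity (suc d) N in q≡true
    ... | false = ∧-zeroʳ (allowed (suc d))
    ... | true with m , _ , m·d≡N ← parity-true⇒∃ _ N q≡true =
      trans (∧-identityʳ (allowed (suc d))) (allowed-odd-divisor {m = suc m} {suc d} 2∤N (≡ᵇ-true⇒≡ m·d≡N))

squareRootParity : ℕ → Bool
squareRootParity N = parity (λ a → suc a * suc a ≡ᵇ N) N

module _ (N : ℕ) where

  private
    factors : ℕ → ℕ → Bool
    factors d m = suc m * suc d ≡ᵇ N

    below diagonal : ℕ → ℕ → Bool
    below    d m = factors d m ∧ (m <ᵇ d)
    diagonal d m = factors d m ∧ (m ≡ᵇ d)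

    factors-trichotomy : ∀ d m → factors d m ≡ below d m xor (diagonal d m xor below m d)
    factors-trichotomy d m with <-cmp m d
    ... | tri< m<d m≢d _
      rewrite <ᵇ-true m<d | ≡ᵇ-false m≢d | <ᵇ-false (<-asym m<d)
            | ∧-identityʳ (factors d m) | ∧-zeroʳ (factors d m) | ∧-zeroʳ (factors m d) =
      sym (xor-identityʳ (factors d m))
    ... | tri≈ _ refl _
      rewrite <ᵇ-false (<-irrefl {m} refl) | ≡ᵇ-true {m} refl | ∧-identityʳ (factors m m) | ∧-zeroʳ (factors m m) =
      sym (xor-identityʳ (factors m m))
    ... | tri> _ m≢d d<m
      rewrite <ᵇ-false (<-asym d<m) | ≡ᵇ-false m≢d | <ᵇ-true d<m
            | ∧-identityʳ (factors m d) | ∧-zeroʳ (factors d m) | *-comm (suc m) (suc d) = refl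

  -- The factorisations N = (m + 1)(d + 1) with m < d and with m > d cancel in pairs,
  -- leaving the diagonal ones.
  divisorParity≡squareRootParity : parity (λ d → quotientParity (suc d) N) N ≡ squareRootParity N
  divisorParity≡squareRootParity = begin
    parity (λ d → parity (factors d) N) N
      ≡⟨ parity-cong N (λ d _ → parity-cong N (λ m _ → factors-trichotomy d m)) ⟩
    parity (λ d → parity (λ m → below d m xor (diagonal d m xor below m d)) N) N
      ≡⟨ parity-cong N (λ d _ → split d) ⟩
    parity (λ d → B d xor (Δ d xor parity (λ m → below m d) N)) N
      ≡⟨ trans (parity-xor B _ N) (cong (parity B N xor_) (parity-xor Δ _ N)) ⟩
    parity B N xor (parity Δ N xor parity (λ d → parity (λ m → below m d) N) N)
      ≡⟨ cong (λ z → parity B N xor (parity Δ N xor z)) (parity-swap below N N) ⟨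
    parity B N xor (parity Δ N xor parity B N)
      ≡⟨ xor-cancelʳ (parity B N) (parity Δ N) ⟩
    parity Δ N
      ≡⟨ parity-cong N (λ d d<N → trans (parity-single (diagonal d) N d d<N off-diagonal) (on-diagonal d)) ⟩
    squareRootParity N ∎
    where
      open ≡-Reasoning
      B Δ : ℕ → Bool
      B d = parity (below d) N
      Δ d = parity (diagonal d) N
      split : ∀ d → parity (λ m → below d m xor (diagonal d m xor below m d)) N ≡ B d xor (Δ d xor parity (λ m → below m d) N)
      split d = trans (parity-xor (below d) _ N) (cong (B d xor_) (parity-xor (diagonal d) (λ m → below m d) N))
      off-diagonal : ∀ {d} m → m < N → m ≢ d → diagonal d m ≡ false
      off-diagonal {d} m _ m≢d rewrite ≡ᵇ-false m≢d = ∧-zeroʳ (factors d m)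
      on-diagonal : ∀ d → diagonal d d ≡ (suc d * suc d ≡ᵇ N)
      on-diagonal d rewrite ≡ᵇ-true {d} refl = ∧-identityʳ (factors d d)

IsSquare : ℕ → Set
IsSquare N = ∃ λ y → y * y ≡ N

square-injective : ∀ a b → a * a ≡ b * b → a ≡ b
square-injective a b a²≡b² with <-cmp a b
... | tri< a<b _ _ = ⊥-elim (<-irrefl a²≡b² (*-mono-< a<b a<b))
... | tri≈ _ a≡b _ = a≡b
... | tri> _ _ a>b = ⊥-elim (<-irrefl (sym a²≡b²) (*-mono-< a>b a>b))

squareRootParity-true⇔ : ∀ N → 1 ≤ N → squareRootParity N ≡ true ⇔ IsSquare N
squareRootParity-true⇔ N 1≤N = mk⇔ to from
  where
    to : squareRootParity N ≡ true → IsSquare N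
    to odd with a , _ , a²≡N ← parity-true⇒∃ _ N odd = suc a , ≡ᵇ-true⇒≡ a²≡N
    from : IsSquare N → squareRootParity N ≡ true
    from (zero  , refl) = ⊥-elim (<-irrefl refl 1≤N)
    from (suc a , a²≡N) =
      trans (parity-single _ N a (subst (suc a ≤_) a²≡N (m≤m*n (suc a) (suc a))) other-roots) (≡ᵇ-true a²≡N)
      where
        other-roots : ∀ m → m < N → m ≢ a → (suc m * suc m ≡ᵇ N) ≡ false
        other-roots m _ m≢a = ≡ᵇ-false (λ m²≡N → m≢a (suc-injective (square-injective _ _ (trans m²≡N (sym a²≡N)))))

square-* : ∀ {a b} → IsSquare a → IsSquare b → IsSquare (a * b)
square-* (x , refl) (y , refl) = x * y , interchange x y
  where
    interchange : ∀ x y → x * y * (x * y) ≡ x * x * (y * y)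
    interchange = solve-∀

module _ {p : ℕ} (p-prime : Prime p) where

  private instance
    p≢0 : NonZero p
    p≢0 = prime⇒nonZero p-prime

  prime∣square⇒∣ : ∀ {y} → p ∣ y * y → p ∣ y
  prime∣square⇒∣ {y} p∣y² with euclidsLemma y y p-prime p∣y²
  ... | inj₁ p∣y = p∣y
  ... | inj₂ p∣y = p∣y

  square-p²*⇒ : ∀ w → IsSquare (p * p * w) → IsSquare w
  square-p²*⇒ w (y , y²≡p²w) with prime∣square⇒∣ {y} (divides (p * w) (trans y²≡p²w (reorder p w)))
    where
      reorder : ∀ p w → p * p * w ≡ p * w * p
      reorder = solve-∀
  ... | divides c refl =
    c , *-cancelˡ-≡ (c * c) w p (*-cancelˡ-≡ (p * (c * c)) (p * w) p
          (trans (reorder c p) (trans y²≡p²w (*-assoc p p w))))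
    where
      reorder : ∀ c p → p * (p * (c * c)) ≡ c * p * (c * p)
      reorder = solve-∀

  square-p^even*⇔ : ∀ α x → IsSquare (p ^ (2 * α) * x) ⇔ IsSquare x
  square-p^even*⇔ α x = mk⇔ (to α x) (square-* (p ^ α , sym p^2α≡p^α²))
    where
      p^2α≡p^α² : p ^ (2 * α) ≡ p ^ α * p ^ α
      p^2α≡p^α² = trans (cong (p ^_) (cong (λ e → α + e) (+-identityʳ α))) (^-distribˡ-+-* p α α)
      to : ∀ α x → IsSquare (p ^ (2 * α) * x) → IsSquare x
      to zero    x sq = subst IsSquare (+-identityʳ x) sq
      to (suc α) x sq = square-p²*⇒ x (to α (p * p * x) (subst IsSquare (reorder α) sq))
        where
          reorder : ∀ α → p ^ (2 * suc α) * x ≡ p ^ (2 * α) * (p * p * x)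
          reorder α = trans (cong (λ e → p ^ e * x) (exponent α)) (regroup (p ^ (2 * α)) p x)
            where
              exponent : ∀ α → 2 * suc α ≡ 2 + 2 * α
              exponent = solve-∀
              regroup : ∀ P p x → p * (p * P) * x ≡ P * (p * p * x)
              regroup = solve-∀

  ¬square-p^odd* : ∀ α M → ¬ p ∣ M → ¬ IsSquare (p ^ (2 * α + 1) * M)
  ¬square-p^odd* zero M p∤M (y , y²≡pM) with prime∣square⇒∣ {y} (divides M (trans y²≡pM (reorder p M)))
    where
      reorder : ∀ p M → p * 1 * M ≡ M * p
      reorder = solve-∀
  ... | divides c refl = p∤M (divides (c * c) (*-cancelˡ-≡ M (c * c * p) p (trans (cong (_* M) (sym (*-identityʳ p))) (trans (sym y²≡pM) (reorder c p)))))
    where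
      reorder : ∀ c p → c * p * (c * p) ≡ p * (c * c * p)
      reorder = solve-∀
  ¬square-p^odd* (suc α) M p∤M sq =
    ¬square-p^odd* α M p∤M (square-p²*⇒ _ (subst IsSquare (reorder α) sq))
    where
      reorder : ∀ α → p ^ (2 * suc α + 1) * M ≡ p * p * (p ^ (2 * α + 1) * M)
      reorder α = trans (cong (λ e → p ^ e * M) (exponent α)) (regroup (p ^ (2 * α + 1)) p M)
        where
          exponent : ∀ α → 2 * suc α + 1 ≡ 2 + (2 * α + 1)
          exponent = solve-∀
          regroup : ∀ P p M → p * (p * P) * M ≡ p * p * (P * M)
          regroup = solve-∀

-- Power series over 𝔽₂

Series : Set
Series = ℕ → Bool

one : Series
one t = t ≡ᵇ 0

shift : ℕ → Series → Series
shift a f t = if a ≤ᵇ t then f (t ∸ a) else false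

infixr 7 [1+q^_]·_

[1+q^_]·_ : ℕ → Series → Series
([1+q^ a ]· f) t = f t xor shift a f t

binomialProduct : ℕ → ℕ → Series
binomialProduct k zero    = one
binomialProduct k (suc m) = [1+q^ suc (k + m) ]· binomialProduct k m

shift-< : ∀ a f t → t < a → shift a f t ≡ false
shift-< a f t t<a rewrite ≤ᵇ-false (<⇒≱ t<a) = refl

shift-shift : ∀ a b f t → shift a (shift b f) t ≡ shift (a + b) f t
shift-shift a b f t with a ≤? t
... | no a≰t rewrite ≤ᵇ-false a≰t | ≤ᵇ-false {a + b} {t} (a≰t ∘ ≤-trans (m≤m+n a b)) = refl
... | yes a≤t rewrite ≤ᵇ-true a≤t with b ≤? t ∸ a
...   | yes b≤t∸a
  rewrite ≤ᵇ-true b≤t∸a | ≤ᵇ-true {a + b} {t} (subst (a + b ≤_) (m+[n∸m]≡n a≤t) (+-monoʳ-≤ a b≤t∸a))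
        | ∸-+-assoc t a b = refl
...   | no b≰t∸a
  rewrite ≤ᵇ-false b≰t∸a | ≤ᵇ-false {a + b} {t} (λ a+b≤t → b≰t∸a (subst (_≤ t ∸ a) (m+n∸m≡n a b) (∸-monoˡ-≤ a a+b≤t)))
  = refl

shift-xor : ∀ a f g t → shift a (λ s → f s xor g s) t ≡ shift a f t xor shift a g t
shift-xor a f g t with a ≤ᵇ t
... | true  = refl
... | false = refl

shift-cong : ∀ a {f g} t → (∀ s → f s ≡ g s) → shift a f t ≡ shift a g t
shift-cong a t f≗g with a ≤ᵇ t
... | true  = f≗g _
... | false = refl

shift-zero : ∀ a t → shift a (λ _ → false) t ≡ false
shift-zero a t with a ≤ᵇ t
... | true  = refl
... | false = refl

shift-one : ∀ a t → shift a one t ≡ (t ≡ᵇ a)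
shift-one a t with a ≤? t
... | yes a≤t rewrite ≤ᵇ-true a≤t = bool-ext (mk⇔
  (λ t∸a≡0 → ≡ᵇ-true (trans (sym (m+[n∸m]≡n a≤t)) (trans (cong (λ u → a + u) (≡ᵇ-true⇒≡ t∸a≡0)) (+-identityʳ a))))
  (λ t≡a → ≡ᵇ-true (trans (cong (_∸ a) (≡ᵇ-true⇒≡ t≡a)) (n∸n≡0 a))))
... | no a≰t rewrite ≤ᵇ-false a≰t = sym (≡ᵇ-false (a≰t ∘ ≤-reflexive ∘ sym))

[1+q^]-cong : ∀ a {f g} → (∀ s → f s ≡ g s) → ∀ t → ([1+q^ a ]· f) t ≡ ([1+q^ a ]· g) t
[1+q^]-cong a f≗g t = cong₂ _xor_ (f≗g t) (shift-cong a t f≗g)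

[1+q^]-comm : ∀ a b f t → ([1+q^ a ]· [1+q^ b ]· f) t ≡ ([1+q^ b ]· [1+q^ a ]· f) t
[1+q^]-comm a b f t = begin
  (f t xor shift b f t) xor shift a (λ s → f s xor shift b f s) t
    ≡⟨ cong ((f t xor shift b f t) xor_) (trans (shift-xor a f (shift b f) t) (cong (shift a f t xor_) shifts-commute)) ⟩
  (f t xor shift b f t) xor (shift a f t xor shift b (shift a f) t)
    ≡⟨ xor-interchange (f t) (shift b f t) (shift a f t) (shift b (shift a f) t) ⟩
  (f t xor shift a f t) xor (shift b f t xor shift b (shift a f) t)
    ≡⟨ cong ((f t xor shift a f t) xor_) (shift-xor b f (shift a f) t) ⟨
  (f t xor shift a f t) xor shift b (λ s → f s xor shift a f s) t ∎
  where
    open ≡-Reasoning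
    shifts-commute : shift a (shift b f) t ≡ shift b (shift a f) t
    shifts-commute = trans (shift-shift a b f t) (trans (cong (λ c → shift c f t) (+-comm a b)) (sym (shift-shift b a f t)))

binomialProduct-suc : ∀ k m t → binomialProduct k (suc m) t ≡ ([1+q^ suc k ]· binomialProduct (suc k) m) t
binomialProduct-suc k zero    t rewrite +-identityʳ k = refl
binomialProduct-suc k (suc m) t = begin
  ([1+q^ suc (k + suc m) ]· binomialProduct k (suc m)) t
    ≡⟨ [1+q^]-cong (suc (k + suc m)) (binomialProduct-suc k m) t ⟩
  ([1+q^ suc (k + suc m) ]· [1+q^ suc k ]· binomialProduct (suc k) m) t
    ≡⟨ [1+q^]-comm (suc (k + suc m)) (suc k) (binomialProduct (suc k) m) t ⟩
  ([1+q^ suc k ]· [1+q^ suc (k + suc m) ]· binomialProduct (suc k) m) t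
    ≡⟨ cong (λ e → ([1+q^ suc k ]· [1+q^ suc e ]· binomialProduct (suc k) m) t) (+-suc k m) ⟩
  ([1+q^ suc k ]· binomialProduct (suc k) (suc m)) t ∎
  where open ≡-Reasoning

triangle : ℕ → ℕ
triangle zero    = 0
triangle (suc k) = triangle k + suc k

-- For j = k + 1 these are the pentagonal numbers j(3j − 1)/2 and j(3j + 1)/2.
pent⁻ pent⁺ : ℕ → ℕ
pent⁻ k = suc k * suc k + triangle k
pent⁺ k = suc k * suc k + triangle (suc k)

pentagonalSeries : ℕ → Series
pentagonalSeries n t = one t xor parity (λ k → (t ≡ᵇ pent⁻ k) xor (t ≡ᵇ pent⁺ k)) n

-- Shanks' finite form of Euler's pentagonal theorem,
--   Σ_{k ≤ n} q^{nk + T_k} ∏_{k < i ≤ n} (1 − q^i) = Σ_{|j| ≤ n} (−1)^j q^{j(3j+1)/2},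
-- read modulo 2: the left-hand side is shanksSum n, the right-hand side pentagonalSeries n.
shanksTerm : ℕ → ℕ → Series
shanksTerm n k = shift (n * k + triangle k) (binomialProduct k (n ∸ k))

shanksSum : ℕ → Series
shanksSum n t = parity (λ k → shanksTerm n k t) (suc n)

module ShanksStep (n t : ℕ) where

  correction tail : ℕ → Bool
  correction k = shift (n * k + triangle k) ([1+q^ k ]· binomialProduct k (n ∸ k)) t
  tail       k = shift (suc n * k + triangle k + suc n) (binomialProduct k (n ∸ k)) t

  shanksTerm-suc : ∀ k → k ≤ n → shanksTerm (suc n) k t ≡ (shanksTerm n k t xor correction k) xor tail k
  shanksTerm-suc k k≤n = begin
    shift X (binomialProduct k (suc n ∸ k)) t
      ≡⟨ cong (λ m → shift X (binomialProduct k m) t) (+-∸-assoc 1 k≤n) ⟩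
    shift X ([1+q^ suc (k + (n ∸ k)) ]· R) t
      ≡⟨ cong (λ e → shift X ([1+q^ suc e ]· R) t) (m+[n∸m]≡n k≤n) ⟩
    shift X ([1+q^ suc n ]· R) t
      ≡⟨ trans (shift-xor X R (shift (suc n) R) t) (cong (shift X R t xor_) (shift-shift X (suc n) R t)) ⟩
    shift X R t xor tail k
      ≡⟨ cong (_xor tail k) (xor-flip {shanksTerm n k t} correction≡) ⟩
    (shanksTerm n k t xor correction k) xor tail k ∎
    where
      open ≡-Reasoning
      R = binomialProduct k (n ∸ k)
      X = suc n * k + triangle k
      Y = n * k + triangle k
      exponent : ∀ n k T → n * k + T + k ≡ suc n * k + T
      exponent = solve-∀
      correction≡ : correction k ≡ shanksTerm n k t xor shift X R t
      correction≡ = trans (shift-xor Y R (shift k R) t)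
        (cong (shanksTerm n k t xor_) (trans (shift-shift Y k R t) (cong (λ e → shift e R t) (exponent n k (triangle k)))))

  correction-zero : correction 0 ≡ false
  correction-zero = trans (shift-cong (n * 0 + 0) t (λ s → xor-same (binomialProduct 0 n s))) (shift-zero (n * 0 + 0) t)

  correction-suc : ∀ k → k < n → correction (suc k) ≡ tail k
  correction-suc k k<n = begin
    shift E ([1+q^ suc k ]· binomialProduct (suc k) (n ∸ suc k)) t
      ≡⟨ shift-cong E t (λ s → sym (binomialProduct-suc k (n ∸ suc k) s)) ⟩
    shift E (binomialProduct k (suc (n ∸ suc k))) t
      ≡⟨ cong (λ m → shift E (binomialProduct k m) t) (sym (+-∸-assoc 1 k<n)) ⟩
    shift E (binomialProduct k (n ∸ k)) t
      ≡⟨ cong (λ e → shift e (binomialProduct k (n ∸ k)) t) (exponent n k (triangle k)) ⟩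
    tail k ∎
    where
      open ≡-Reasoning
      E = n * suc k + triangle (suc k)
      exponent : ∀ n k T → n * suc k + (T + suc k) ≡ suc n * k + T + suc n
      exponent = solve-∀

  tail-last : tail n ≡ (t ≡ᵇ pent⁻ n)
  tail-last = trans (cong (λ m → shift E (binomialProduct n m) t) (n∸n≡0 n))
                    (trans (shift-one E t) (cong (t ≡ᵇ_) (exponent n (triangle n))))
    where
      E = suc n * n + triangle n + suc n
      exponent : ∀ n T → suc n * n + T + suc n ≡ suc n * suc n + T
      exponent = solve-∀

  shanksTerm-last : shanksTerm (suc n) (suc n) t ≡ (t ≡ᵇ pent⁺ n)
  shanksTerm-last = trans (cong (λ m → shift (pent⁺ n) (binomialProduct (suc n) m) t) (n∸n≡0 n)) (shift-one (pent⁺ n) t)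

shanksSum-suc : ∀ n t → shanksSum (suc n) t ≡ shanksSum n t xor ((t ≡ᵇ pent⁻ n) xor (t ≡ᵇ pent⁺ n))
shanksSum-suc n t = begin
  parity F (suc n) xor F (suc n)
    ≡⟨ cong (_xor F (suc n)) (parity-cong (suc n) (λ k k<1+n → shanksTerm-suc k (≤-pred k<1+n))) ⟩
  parity (λ k → (C k xor H k) xor B k) (suc n) xor F (suc n)
    ≡⟨ cong (_xor F (suc n)) (trans (parity-xor _ B (suc n)) (cong (_xor parity B (suc n)) (parity-xor C H (suc n)))) ⟩
  ((shanksSum n t xor parity H (suc n)) xor (parity B n xor B n)) xor F (suc n)
    ≡⟨ cong (λ h → ((shanksSum n t xor h) xor (parity B n xor B n)) xor F (suc n)) telescope ⟩
  ((shanksSum n t xor parity B n) xor (parity B n xor B n)) xor F (suc n)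
    ≡⟨ cong (_xor F (suc n)) (xor-cancel-middle (shanksSum n t) (parity B n) (B n)) ⟩
  (shanksSum n t xor B n) xor F (suc n)
    ≡⟨ xor-assoc (shanksSum n t) (B n) (F (suc n)) ⟩
  shanksSum n t xor (B n xor F (suc n))
    ≡⟨ cong₂ (λ u v → shanksSum n t xor (u xor v)) tail-last shanksTerm-last ⟩
  shanksSum n t xor ((t ≡ᵇ pent⁻ n) xor (t ≡ᵇ pent⁺ n)) ∎
  where
    open ≡-Reasoning
    open ShanksStep n t
    F C H B : ℕ → Bool
    F k = shanksTerm (suc n) k t
    C k = shanksTerm n k t
    H   = correction
    B   = tail
    telescope : parity H (suc n) ≡ parity B n
    telescope = trans (parity-suc H n) (cong₂ _xor_ correction-zero (parity-cong n correction-suc))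

shanksSum≡pentagonalSeries : ∀ n t → shanksSum n t ≡ pentagonalSeries n t
shanksSum≡pentagonalSeries zero    t = sym (xor-identityʳ (one t))
shanksSum≡pentagonalSeries (suc n) t = begin
  shanksSum (suc n) t                                   ≡⟨ shanksSum-suc n t ⟩
  shanksSum n t xor P n                                 ≡⟨ cong (_xor P n) (shanksSum≡pentagonalSeries n t) ⟩
  (one t xor parity P n) xor P n                        ≡⟨ xor-assoc (one t) (parity P n) (P n) ⟩
  pentagonalSeries (suc n) t                            ∎
  where
    open ≡-Reasoning
    P : ℕ → Bool
    P k = (t ≡ᵇ pent⁻ k) xor (t ≡ᵇ pent⁺ k)

shanksSum-low : ∀ n t → t ≤ n → shanksSum n t ≡ binomialProduct 0 n t
shanksSum-low n t t≤n = begin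
  shanksSum n t
    ≡⟨ parity-suc (λ k → shanksTerm n k t) n ⟩
  shanksTerm n 0 t xor parity (λ k → shanksTerm n (suc k) t) n
    ≡⟨ cong₂ _xor_ (cong (λ e → shift e (binomialProduct 0 n) t) (trans (+-identityʳ (n * 0)) (*-zeroʳ n)))
                  (parity-false _ n (λ k _ → shift-< _ (binomialProduct (suc k) (n ∸ suc k)) t (t<exponent k))) ⟩
  binomialProduct 0 n t xor false
    ≡⟨ xor-identityʳ (binomialProduct 0 n t) ⟩
  binomialProduct 0 n t ∎
  where
    open ≡-Reasoning
    t<exponent : ∀ k → t < n * suc k + triangle (suc k)
    t<exponent k = ≤-<-trans (≤-trans t≤n (m≤m*n n (suc k))) (m<m+n (n * suc k) (<-≤-trans 0<1+n (m≤n+m (suc k) (triangle k))))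

binomialProduct≡pentagonalSeries : ∀ n t → t ≤ n → binomialProduct 0 n t ≡ pentagonalSeries n t
binomialProduct≡pentagonalSeries n t t≤n = trans (sym (shanksSum-low n t t≤n)) (shanksSum≡pentagonalSeries n t)

-- Pentagonal numbers and the squares 24t + 1

triangle-double : ∀ k → 2 * triangle k ≡ k * suc k
triangle-double zero    = refl
triangle-double (suc k) = trans (*-distribˡ-+ 2 (triangle k) (suc k)) (trans (cong (_+ 2 * suc k) (triangle-double k)) (step k))
  where
    step : ∀ k → k * suc k + 2 * suc k ≡ suc k * suc (suc k)
    step = solve-∀

root⁻ root⁺ : ℕ → ℕ
root⁻ k = 5 + k * 6
root⁺ k = 1 + suc k * 6

pent⁻-square : ∀ k → 24 * pent⁻ k + 1 ≡ root⁻ k * root⁻ k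
pent⁻-square k = trans (expand k (triangle k)) (trans (cong (λ T → 24 * (suc k * suc k) + 12 * T + 1) (triangle-double k)) (square k))
  where
    expand : ∀ k T → 24 * (suc k * suc k + T) + 1 ≡ 24 * (suc k * suc k) + 12 * (2 * T) + 1
    expand = solve-∀
    square : ∀ k → 24 * (suc k * suc k) + 12 * (k * suc k) + 1 ≡ (5 + k * 6) * (5 + k * 6)
    square = solve-∀

pent⁺-square : ∀ k → 24 * pent⁺ k + 1 ≡ root⁺ k * root⁺ k
pent⁺-square k = trans (expand k (triangle k)) (trans (cong (λ T → 24 * (suc k * suc k) + 12 * T + 24 * suc k + 1) (triangle-double k)) (square k))
  where
    expand : ∀ k T → 24 * (suc k * suc k + (T + suc k)) + 1 ≡ 24 * (suc k * suc k) + 12 * (2 * T) + 24 * suc k + 1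
    expand = solve-∀
    square : ∀ k → 24 * (suc k * suc k) + 12 * (k * suc k) + 24 * suc k + 1 ≡ (1 + suc k * 6) * (1 + suc k * 6)
    square = solve-∀

k<pent⁻ : ∀ k → k < pent⁻ k
k<pent⁻ k = ≤-trans (m≤m*n (suc k) (suc k)) (m≤m+n (suc k * suc k) (triangle k))

k<pent⁺ : ∀ k → k < pent⁺ k
k<pent⁺ k = ≤-trans (m≤m*n (suc k) (suc k)) (m≤m+n (suc k * suc k) (triangle (suc k)))

24*+1-injective : ∀ t u → 24 * t + 1 ≡ 24 * u + 1 → t ≡ u
24*+1-injective t u eq = *-cancelˡ-≡ t u 24 (+-cancelʳ-≡ 1 (24 * t) (24 * u) eq)

≡ᵇ-via-roots : ∀ t y P r → 24 * t + 1 ≡ y * y → 24 * P + 1 ≡ r * r → (t ≡ᵇ P) ≡ (y ≡ᵇ r)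
≡ᵇ-via-roots t y P r t-root P-root = bool-ext (mk⇔
  (λ t≡ᵇP → ≡ᵇ-true (square-injective y r (trans (sym t-root) (trans (cong (λ u → 24 * u + 1) (≡ᵇ-true⇒≡ {t} t≡ᵇP)) P-root))))
  (λ y≡ᵇr → ≡ᵇ-true (24*+1-injective t P (trans t-root (trans (cong (λ u → u * u) (≡ᵇ-true⇒≡ {y} y≡ᵇr)) (sym P-root))))))

-- A square root of 24t + 1 is prime to 6, so it is 1, 6k + 5 or 6k + 7.
data PentagonalRoot : ℕ → Set where
  is-1     : PentagonalRoot 1
  is-root⁻ : ∀ k → PentagonalRoot (root⁻ k)
  is-root⁺ : ∀ k → PentagonalRoot (root⁺ k)

pentagonalRoot : ∀ y t → y * y ≡ 24 * t + 1 → PentagonalRoot y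
pentagonalRoot y t y²≡ = classify (y % 6) (y / 6) (m%n<n y 6) (m≡m%n+[m/n]*n y 6) r²%6≡1
  where
    r = y % 6
    q = y / 6
    r²%6≡1 : (r * r) % 6 ≡ 1
    r²%6≡1 = begin
      (r * r) % 6                            ≡⟨ [m+kn]%n≡m%n (r * r) (q * (2 * r + q * 6)) 6 ⟨
      (r * r + q * (2 * r + q * 6) * 6) % 6  ≡⟨ cong (_% 6) (expand r q) ⟩
      ((r + q * 6) * (r + q * 6)) % 6        ≡⟨ cong (λ z → (z * z) % 6) (m≡m%n+[m/n]*n y 6) ⟨
      (y * y) % 6                            ≡⟨ cong (_% 6) (trans y²≡ (regroup t)) ⟩
      (1 + 4 * t * 6) % 6                    ≡⟨ [m+kn]%n≡m%n 1 (4 * t) 6 ⟩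
      1                                      ∎
      where
        open ≡-Reasoning
        expand : ∀ r q → r * r + q * (2 * r + q * 6) * 6 ≡ (r + q * 6) * (r + q * 6)
        expand = solve-∀
        regroup : ∀ t → 24 * t + 1 ≡ 1 + 4 * t * 6
        regroup = solve-∀
    classify : ∀ r q → r < 6 → y ≡ r + q * 6 → (r * r) % 6 ≡ 1 → PentagonalRoot y
    classify 1 zero    _ refl _ = is-1
    classify 1 (suc k) _ refl _ = is-root⁺ k
    classify 5 k       _ refl _ = is-root⁻ k
    classify 0 _ _ _ ()
    classify 2 _ _ _ ()
    classify 3 _ _ _ ()
    classify 4 _ _ _ ()
    classify (suc (suc (suc (suc (suc (suc _)))))) _ (s≤s (s≤s (s≤s (s≤s (s≤s (s≤s ())))))) _ _

pentagonalSeries-sound : ∀ n t → pentagonalSeries n t ≡ true → IsSquare (24 * t + 1)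
pentagonalSeries-sound n t series≡true with xor-true (one t) _ series≡true
... | inj₁ t≡ᵇ0 rewrite ≡ᵇ-true⇒≡ {t} t≡ᵇ0 = 1 , refl
... | inj₂ odd with k , _ , term≡true ← parity-true⇒∃ _ n odd with xor-true (t ≡ᵇ pent⁻ k) _ term≡true
...   | inj₁ t≡ᵇpent⁻ rewrite ≡ᵇ-true⇒≡ {t} t≡ᵇpent⁻ = root⁻ k , sym (pent⁻-square k)
...   | inj₂ t≡ᵇpent⁺ rewrite ≡ᵇ-true⇒≡ {t} t≡ᵇpent⁺ = root⁺ k , sym (pent⁺-square k)

parity-indicator : ∀ n k → k < n → parity (λ m → m ≡ᵇ k) n ≡ true
parity-indicator n k k<n = trans (parity-single _ n k k<n (λ _ _ → ≡ᵇ-false)) (≡ᵇ-true {k} refl)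

rootTerm-root⁻ : ∀ k m → (root⁻ k ≡ᵇ root⁻ m) xor (root⁻ k ≡ᵇ root⁺ m) ≡ (m ≡ᵇ k)
rootTerm-root⁻ k m = trans (cong₂ _xor_ same-class other-class) (xor-identityʳ (m ≡ᵇ k))
  where
    same-class : (root⁻ k ≡ᵇ root⁻ m) ≡ (m ≡ᵇ k)
    same-class = bool-ext (mk⇔
      (λ e → ≡ᵇ-true (sym (*-cancelʳ-≡ k m 6 (+-cancelˡ-≡ 5 (k * 6) (m * 6) (≡ᵇ-true⇒≡ {root⁻ k} e)))))
      (λ e → ≡ᵇ-true (cong root⁻ (sym (≡ᵇ-true⇒≡ {m} e)))))
    other-class : (root⁻ k ≡ᵇ root⁺ m) ≡ false
    other-class = ≡ᵇ-false {root⁻ k} {root⁺ m} (λ e → 5≢1 (trans (sym ([m+kn]%n≡m%n 5 k 6)) (trans (cong (_% 6) e) ([m+kn]%n≡m%n 1 (suc m) 6))))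
      where
        5≢1 : 5 ≢ 1
        5≢1 ()

rootTerm-root⁺ : ∀ k m → (root⁺ k ≡ᵇ root⁻ m) xor (root⁺ k ≡ᵇ root⁺ m) ≡ (m ≡ᵇ k)
rootTerm-root⁺ k m = cong₂ _xor_ other-class same-class
  where
    same-class : (root⁺ k ≡ᵇ root⁺ m) ≡ (m ≡ᵇ k)
    same-class = bool-ext (mk⇔
      (λ e → ≡ᵇ-true (sym (suc-injective (*-cancelʳ-≡ (suc k) (suc m) 6 (+-cancelˡ-≡ 1 (suc k * 6) (suc m * 6) (≡ᵇ-true⇒≡ {root⁺ k} e))))))
      (λ e → ≡ᵇ-true (cong root⁺ (sym (≡ᵇ-true⇒≡ {m} e)))))
    other-class : (root⁺ k ≡ᵇ root⁻ m) ≡ false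
    other-class = ≡ᵇ-false {root⁺ k} {root⁻ m} (λ e → 1≢5 (trans (sym ([m+kn]%n≡m%n 1 (suc k) 6)) (trans (cong (_% 6) e) ([m+kn]%n≡m%n 5 m 6))))
      where
        1≢5 : 1 ≢ 5
        1≢5 ()

pentagonalSeries-complete : ∀ n t y → t ≤ n → 24 * t + 1 ≡ y * y → pentagonalSeries n t ≡ true
pentagonalSeries-complete n t y t≤n t-root = trans in-roots (by-shape (pentagonalRoot y t (sym t-root)) t-root)
  where
    rootSeries : ℕ → Bool
    rootSeries y = (y ≡ᵇ 1) xor parity (λ m → (y ≡ᵇ root⁻ m) xor (y ≡ᵇ root⁺ m)) n
    in-roots : pentagonalSeries n t ≡ rootSeries y
    in-roots = cong₂ _xor_ (≡ᵇ-via-roots t y 0 1 t-root refl) (parity-cong n (λ m _ →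
      cong₂ _xor_ (≡ᵇ-via-roots t y (pent⁻ m) (root⁻ m) t-root (pent⁻-square m))
                  (≡ᵇ-via-roots t y (pent⁺ m) (root⁺ m) t-root (pent⁺-square m))))
    by-shape : ∀ {y} → PentagonalRoot y → 24 * t + 1 ≡ y * y → rootSeries y ≡ true
    by-shape is-1 _ = cong (true xor_) (parity-false _ n (λ _ _ → refl))
    by-shape (is-root⁻ k) t-root = trans (parity-cong n (λ m _ → rootTerm-root⁻ k m)) (parity-indicator n k k<n)
      where
        k<n : k < n
        k<n = <-≤-trans (subst (k <_) (sym (24*+1-injective t _ (trans t-root (sym (pent⁻-square k))))) (k<pent⁻ k)) t≤n
    by-shape (is-root⁺ k) t-root = trans (parity-cong n (λ m _ → rootTerm-root⁺ k m)) (parity-indicator n k k<n)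
      where
        k<n : k < n
        k<n = <-≤-trans (subst (k <_) (sym (24*+1-injective t _ (trans t-root (sym (pent⁺-square k))))) (k<pent⁺ k)) t≤n

pentagonalSeries-true⇔ : ∀ n t → t ≤ n → pentagonalSeries n t ≡ true ⇔ IsSquare (24 * t + 1)
pentagonalSeries-true⇔ n t t≤n = mk⇔ (pentagonalSeries-sound n t) (λ (y , y²≡) → pentagonalSeries-complete n t y t≤n (sym y²≡))

-- Both sides modulo 4

odd⇒≥1 : ∀ {N} → ¬ 2 ∣ N → 1 ≤ N
odd⇒≥1 {zero}  2∤0 = ⊥-elim (2∤0 (2 ∣0))
odd⇒≥1 {suc N} _   = s≤s z≤n

pbar612-odd-mod4 : ∀ N → ¬ 2 ∣ N → ∃ λ a → pbar612 N ≡ 4 * a + 2 * bit (squareRootParity N)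
pbar612-odd-mod4 N 2∤N with a , pbar≡ ← ov-mod4 N N (odd⇒≥1 2∤N) =
  a , trans pbar≡ (cong (λ b → 4 * a + 2 * bit b)
        (trans (allowedDivisorParity-odd N N 2∤N) (divisorParity≡squareRootParity N)))

bit-difference : ∀ z₁ z₂ x y → ∃ λ w →
  (+ 2 *ℤ z₁ +ℤ + bit x) -ℤ (+ 2 *ℤ z₂ +ℤ + bit y) ≡ + 2 *ℤ w +ℤ + bit (x xor y)
bit-difference z₁ z₂ false false = z₁ -ℤ z₂ , identity z₁ z₂
  where
    identity : ∀ a b → (+ 2 *ℤ a +ℤ + 0) -ℤ (+ 2 *ℤ b +ℤ + 0) ≡ + 2 *ℤ (a -ℤ b) +ℤ + 0
    identity = ℤ-Solver.solve-∀
bit-difference z₁ z₂ false true  = z₁ -ℤ z₂ -ℤ + 1 , identity z₁ z₂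
  where
    identity : ∀ a b → (+ 2 *ℤ a +ℤ + 0) -ℤ (+ 2 *ℤ b +ℤ + 1) ≡ + 2 *ℤ (a -ℤ b -ℤ + 1) +ℤ + 1
    identity = ℤ-Solver.solve-∀
bit-difference z₁ z₂ true  false = z₁ -ℤ z₂ , identity z₁ z₂
  where
    identity : ∀ a b → (+ 2 *ℤ a +ℤ + 1) -ℤ (+ 2 *ℤ b +ℤ + 0) ≡ + 2 *ℤ (a -ℤ b) +ℤ + 1
    identity = ℤ-Solver.solve-∀
bit-difference z₁ z₂ true  true  = z₁ -ℤ z₂ , identity z₁ z₂
  where
    identity : ∀ a b → (+ 2 *ℤ a +ℤ + 1) -ℤ (+ 2 *ℤ b +ℤ + 1) ≡ + 2 *ℤ (a -ℤ b) +ℤ + 0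
    identity = ℤ-Solver.solve-∀

prodF-parity : ∀ k n → ∃ λ z → prodF k n ≡ + 2 *ℤ z +ℤ + bit (binomialProduct 0 k n)
prodF-parity zero    zero    = + 0 , refl
prodF-parity zero    (suc n) = + 0 , refl
prodF-parity (suc k) n with z₁ , e₁ ← prodF-parity k n | suc k ≤ᵇ n
... | true with z₂ , e₂ ← prodF-parity k (n ∸ suc k) =
  let w , ew = bit-difference z₁ z₂ (binomialProduct 0 k n) (binomialProduct 0 k (n ∸ suc k))
  in  w , trans (cong₂ _-ℤ_ e₁ e₂) ew
... | false = z₁ , trans (ℤ.+-identityʳ (prodF k n))
                   (trans e₁ (cong (λ b → + 2 *ℤ z₁ +ℤ + bit b) (sym (xor-identityʳ (binomialProduct 0 k n)))))

f1coeff-parity : ∀ n → ∃ λ z → f1coeff n ≡ + 2 *ℤ z +ℤ + bit (pentagonalSeries n n)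
f1coeff-parity n with z , f1≡ ← prodF-parity n n =
  z , trans f1≡ (cong (λ b → + 2 *ℤ z +ℤ + bit b) (binomialProduct≡pentagonalSeries n n ≤-refl))

4∣ℤ-difference : ∀ {X F b} → (∃ λ a → X ≡ 4 * a + 2 * bit b) → (∃ λ z → F ≡ + 2 *ℤ z +ℤ + bit b) →
                 + 4 ∣ℤ (+ X -ℤ + 2 *ℤ F)
4∣ℤ-difference {X} {F} {b} (a , X≡) (z , F≡) =
  subst (λ d → 4 ∣ ℤ.∣ d ∣) (sym difference≡) (subst (4 ∣_) (sym (ℤ.abs-* (+ 4) w)) (m∣m*n ℤ.∣ w ∣))
  where
    w = + a -ℤ z
    identity : ∀ A B Z → (+ 4 *ℤ A +ℤ + 2 *ℤ B) -ℤ + 2 *ℤ (+ 2 *ℤ Z +ℤ B) ≡ + 4 *ℤ (A -ℤ Z)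
    identity = ℤ-Solver.solve-∀
    difference≡ : + X -ℤ + 2 *ℤ F ≡ + 4 *ℤ w
    difference≡ = trans (cong₂ (λ u v → u -ℤ + 2 *ℤ v)
                     (trans (cong +_ X≡) (trans (ℤ.pos-+ (4 * a) (2 * bit b)) (cong₂ _+ℤ_ (ℤ.pos-* 4 a) (ℤ.pos-* 2 (bit b))))) F≡)
                  (identity (+ a) (+ bit b) z)

pbar612-2f1coeff-mod4 : ∀ N n → ¬ 2 ∣ N → (IsSquare N ⇔ IsSquare (24 * n + 1)) →
                        + 4 ∣ℤ (+ pbar612 N -ℤ + 2 *ℤ f1coeff n)
pbar612-2f1coeff-mod4 N n 2∤N N□⇔ = 4∣ℤ-difference
  (subst (λ b → ∃ λ a → pbar612 N ≡ 4 * a + 2 * bit b) parities-agree (pbar612-odd-mod4 N 2∤N))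
  (f1coeff-parity n)
  where
    parities-agree : squareRootParity N ≡ pentagonalSeries n n
    parities-agree = bool-ext (⇔-sym (pentagonalSeries-true⇔ n n ≤-refl) ⇔-∘
                                (N□⇔ ⇔-∘ squareRootParity-true⇔ N (odd⇒≥1 2∤N)))

4∣pbar612-nonsquare : ∀ N → ¬ 2 ∣ N → ¬ IsSquare N → 4 ∣ pbar612 N
4∣pbar612-nonsquare N 2∤N ¬N□ = let a , pbar≡ = pbar612-odd-mod4 N 2∤N in
  divides a (trans pbar≡ (trans (cong (λ b → 4 * a + 2 * bit b) not-square) (times4 a)))
  where
    not-square : squareRootParity N ≡ false
    not-square = ¬-not (¬N□ ∘ Equivalence.to (squareRootParity-true⇔ N (odd⇒≥1 2∤N)))
    times4 : ∀ a → 4 * a + 2 * 0 ≡ a * 4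
    times4 = solve-∀

-- Arithmetic of the prime p

prime∤* : ∀ {p m n} → Prime p → ¬ p ∣ m → ¬ p ∣ n → ¬ p ∣ m * n
prime∤* {m = m} {n} p-prime p∤m p∤n p∣mn with euclidsLemma m n p-prime p∣mn
... | inj₁ p∣m = p∤m p∣m
... | inj₂ p∣n = p∤n p∣n

prime∤^ : ∀ {p m} → Prime p → ¬ p ∣ m → ∀ k → ¬ p ∣ m ^ k
prime∤^ p-prime p∤m zero    p∣1 = ¬prime[1] (subst Prime (∣1⇒≡1 p∣1) p-prime)
prime∤^ p-prime p∤m (suc k) = prime∤* p-prime p∤m (prime∤^ p-prime p∤m k)

∤-smaller : ∀ {p m} → 0 < m → m < p → ¬ p ∣ m
∤-smaller {m = suc m} _ m<p p∣m = <⇒≱ m<p (∣⇒≤ p∣m)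

prime-no-proper-divisor : ∀ {p d} → Prime p → 1 < d → d < p → ¬ d ∣ p
prime-no-proper-divisor p-prime 1<d d<p d∣p with prime⇒irreducible p-prime d∣p
... | inj₁ refl = <-irrefl refl 1<d
... | inj₂ refl = <-irrefl refl d<p

prime≥5-odd : ∀ {p} → Prime p → 5 ≤ p → ¬ 2 ∣ p
prime≥5-odd p-prime 5≤p = prime-no-proper-divisor p-prime (s≤s (s≤s z≤n)) (≤-trans (s≤s (s≤s (s≤s z≤n))) 5≤p)

odd-24*+ : ∀ {a} x → ¬ 2 ∣ a → ¬ 2 ∣ 24 * x + a
odd-24*+ x 2∤a 2∣24x+a = 2∤a (∣m+n∣m⇒∣n 2∣24x+a (∣m⇒∣m*n x (divides 12 refl)))

prime∤24 : ∀ {p} → Prime p → 5 ≤ p → ¬ p ∣ 24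
prime∤24 p-prime 5≤p = prime∤* p-prime p∤2 (prime∤* p-prime p∤2 (prime∤* p-prime p∤2 p∤3))
  where
    p∤2 = ∤-smaller (s≤s z≤n) (≤-trans (s≤s (s≤s (s≤s z≤n))) 5≤p)
    p∤3 = ∤-smaller (s≤s z≤n) (≤-trans (s≤s (s≤s (s≤s (s≤s z≤n)))) 5≤p)

prime∤24[pn+j]+p : ∀ {p} → Prime p → 5 ≤ p → ∀ n j → 1 ≤ j → j < p → ¬ p ∣ 24 * (p * n + j) + p
prime∤24[pn+j]+p {p} p-prime 5≤p n j 1≤j j<p p∣M =
  prime∤* p-prime (prime∤24 p-prime 5≤p) (∤-smaller 1≤j j<p) (∣m+n∣m⇒∣n (subst (p ∣_) (regroup p n j) p∣M) (∣m⇒∣m*n (24 * n + 1) ∣-refl))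
  where
    regroup : ∀ p n j → 24 * (p * n + j) + p ≡ p * (24 * n + 1) + 24 * j
    regroup = solve-∀

mainTheorem5 : (p : ℕ) → Prime p → 5 ≤ p → (j : ℕ) → 1 ≤ j → j < p → (α n : ℕ) →
    ((+ 4) ∣ℤ ((+ pbar612 (24 * p ^ (2 * α) * n + p ^ (2 * α))) -ℤ (+ 2) *ℤ f1coeff n))
    × (4 ∣ pbar612 (p ^ (2 * α + 1) * (24 * (p * n + j) + p)))
mainTheorem5 p p-prime 5≤p j 1≤j j<p α n =
  subst (λ N → + 4 ∣ℤ (+ pbar612 N -ℤ + 2 *ℤ f1coeff n)) (sym (factor (p ^ (2 * α)) n))
    (pbar612-2f1coeff-mod4 _ n (prime∤* prime[2] (prime∤^ prime[2] 2∤p (2 * α)) (odd-24*+ n 2∤1))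
                              (square-p^even*⇔ p-prime α (24 * n + 1))) ,
  4∣pbar612-nonsquare _ (prime∤* prime[2] (prime∤^ prime[2] 2∤p (2 * α + 1)) (odd-24*+ (p * n + j) 2∤p))
                        (¬square-p^odd* p-prime α _ (prime∤24[pn+j]+p p-prime 5≤p n j 1≤j j<p))
  where
    2∤p : ¬ 2 ∣ p
    2∤p = prime≥5-odd p-prime 5≤p
    2∤1 : ¬ 2 ∣ 1
    2∤1 = ∤-smaller 0<1+n ≤-refl
    factor : ∀ P n → 24 * P * n + P ≡ P * (24 * n + 1)
    factor = solve-∀
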